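{- Let $F$ be a function from the nonnegative integers to the complex numbers. If $\{A_n\}_{n\ge0}$ is an even sequence, then $$\sum_{k=0}^n\binom nk(-1)^kA_k\Big(\sum_{s=0}^k\binom ks(-1)^s\big(F(s)-F(n-s)\big)\Big)=0\quad(n=0,1,2,\ldots).$$ If $\{A_n\}_{n\ge0}$ is an odd sequence, then $$\sum_{k=0}^n\binom nk(-1)^kA_k\Big(\sum_{s=0}^k\binom ks(-1)^s\big(F(s)+F(n-s)\big)\Big)=0\quad(n=0,1,2,\ldots).$$
   Context: A sequence $\{a_n\}_{n\ge0}$ of real (or complex) numbers is called an even sequence if $\sum_{k=0}^n\binom nk(-1)^ka_k=a_n$ for all $n=0,1,2,\ldots$, and an odd sequence if $\sum_{k=0}^n\binom nk(-1)^ka_k=-a_n$ for all $n=0,1,2,\ldots$. -}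

module Defs where

open import Level using (Level)
open import Data.Nat using (ℕ; zero; suc; _∸_)
open import Data.Nat.Combinatorics using (_C_)
open import Algebra.Bundles using (CommutativeRing)

module RingDefs {c ℓ : Level} (R : CommutativeRing c ℓ) where
  open CommutativeRing R

  ι : ℕ → Carrier
  ι zero    = 0#
  ι (suc n) = 1# + ι n

  sgn : ℕ → Carrier
  sgn zero    = 1#
  sgn (suc k) = - (sgn k)

  Σ≤ : ℕ → (ℕ → Carrier) → Carrier
  Σ≤ zero    f = f 0
  Σ≤ (suc n) f = Σ≤ n f + f (suc n)

  binomT : (ℕ → Carrier) → ℕ → Carrier
  binomT a n = Σ≤ n (λ k → ι (n C k) * (sgn k * a k))

  IsEven : (ℕ → Carrier) → Set ℓ
  IsEven a = ∀ n → binomT a n ≈ a n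

  IsOdd : (ℕ → Carrier) → Set ℓ
  IsOdd a = ∀ n → binomT a n ≈ - a n

  evenExpr : (ℕ → Carrier) → (ℕ → Carrier) → ℕ → Carrier
  evenExpr A F n = Σ≤ n (λ k → ι (n C k) * (sgn k * (A k *
      Σ≤ k (λ s → ι (k C s) * (sgn s * (F s - F (n ∸ s)))))))

  oddExpr : (ℕ → Carrier) → (ℕ → Carrier) → ℕ → Carrier
  oddExpr A F n = Σ≤ n (λ k → ι (n C k) * (sgn k * (A k *
      Σ≤ k (λ s → ι (k C s) * (sgn s * (F s + F (n ∸ s)))))))

-- Let A be even or odd, i.e. binomT A = ε · A with ε = 1 resp. ε = -1 (so ε² = 1).
-- The proof works over an arbitrary commutative ring and follows four steps.
--
-- 1. The iterated differences  Δ m s = Σⱼ C(m,j) (-1)ʲ A(s+j)  satisfy Pascal's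
--    recurrence  Δ (m+1) s = Δ m s - Δ m (s+1),  and  Δ 0 s = A s,  Δ m 0 = binomT A m.
--    Induction on m then gives the symmetry  Δ m s = ε · Δ s m.
-- 2. Exchanging the two sums, the double sum with inner summand G s equals
--    Σₛ W n s · G s  with weights  W n s = Σₖ C(n,k)(-1)ᵏ A k · C(k,s)(-1)ˢ.
-- 3. The identity C(s+m, s+j) C(s+j, s) = C(s+m, s) C(m, j) gives
--    W (s+m) s = C(s+m, s) · Δ m s, so by step 1 the weights are ε-symmetric:
--    W n (n-s) = ε · W n s.
-- 4. Reversing the order of summation, for G s = F s + η F(n-s) with η ε = -1 the
--    sum becomes (1 + η ε) Σₛ W n s F s = 0.  Even sequences use (ε, η) = (1, -1),
--    odd sequences (ε, η) = (-1, 1); these are exactly evenExpr and oddExpr.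
module Submission where

open import Defs
open import Level using (Level)
open import Algebra.Bundles using (CommutativeRing)
open import Data.Nat as ℕ using (ℕ; zero; suc; _∸_; _≤_; _<_; z≤n; s≤s)
import Data.Nat.Properties as ℕP
open import Data.Nat.Combinatorics using (_C_; nCk≡nC[n∸k]; k>n⇒nCk≡0; nCk+nC[k+1]≡[n+1]C[k+1])
open import Data.Product using (_×_; _,_)
import Relation.Binary.PropositionalEquality as P
import Algebra.Properties.Ring as RingProperties
import Algebra.Properties.AbelianGroup as AbelianGroupProperties
import Algebra.Properties.CommutativeSemigroup as CommutativeSemigroupProperties
import Algebra.Properties.Semiring.Mult as SemiringMult
import Relation.Binary.Reasoning.Setoid as SetoidReasoning

module Binomial where
  open import Data.Nat
  open import Data.Nat.Properties
  open import Data.Nat.Combinatorics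
  open import Data.Nat.DivMod using (m/n*n≡m)
  open import Relation.Binary.PropositionalEquality
  open import Relation.Nullary using (yes; no)
  open import Data.Nat.Solver using (module +-*-Solver)
  open +-*-Solver

  C-factorial : ∀ {n k} → k ≤ n → (n C k) * (k ! * (n ∸ k) !) ≡ n !
  C-factorial {n} {k} k≤n =
    trans (cong (_* (k ! * (n ∸ k) !)) (nCk≡n!/k![n-k]! k≤n))
          (m/n*n≡m {{k !* (n ∸ k) !≢0}} (k![n∸k]!∣n! k≤n))

  C-factorial-+ : ∀ a b → ((a + b) C a) * (a ! * b !) ≡ (a + b) !
  C-factorial-+ a b =
    trans (cong (λ t → ((a + b) C a) * (a ! * t !)) (sym (m+n∸m≡n a b))) (C-factorial (m≤m+n a b))

  -- Choosing an (s+j)-subset of an (s+m)-set and then an s-subset of it is the same as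
  -- choosing the s-subset first and then j of the remaining m elements.
  C-choose-twice : ∀ s m j → ((s + m) C (s + j)) * ((s + j) C s) ≡ ((s + m) C s) * (m C j)
  C-choose-twice s m j with j ≤? m
  ... | no j≰m = begin
    ((s + m) C (s + j)) * ((s + j) C s) ≡⟨ cong (_* ((s + j) C s)) (k>n⇒nCk≡0 (+-monoʳ-< s (≰⇒> j≰m))) ⟩
    0                                   ≡⟨ sym (*-zeroʳ ((s + m) C s)) ⟩
    ((s + m) C s) * 0                   ≡⟨ cong (((s + m) C s) *_) (sym (k>n⇒nCk≡0 (≰⇒> j≰m))) ⟩
    ((s + m) C s) * (m C j)             ∎
    where open ≡-Reasoning
  ... | yes j≤m = *-cancelʳ-≡ _ _ (x * (y * z)) {{m*n≢0 _ _ {{s !≢0}} {{j !* (m ∸ j) !≢0}}}} both-sides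
    where
    open ≡-Reasoning
    x = s !
    y = j !
    z = (m ∸ j) !
    -- (s+m) - (s+j) = m - j, so the outer coefficient has complementary factorial z.
    outer : ((s + m) C (s + j)) * ((s + j) ! * z) ≡ (s + m) !
    outer = trans (cong (λ t → ((s + m) C (s + j)) * ((s + j) ! * t !)) (sym ([m+n]∸[m+o]≡n∸o s m j)))
                  (C-factorial (+-monoʳ-≤ s j≤m))
    -- Both products, multiplied by s! j! (m-j)!, equal (s+m)!.
    both-sides : ((s + m) C (s + j)) * ((s + j) C s) * (x * (y * z)) ≡ ((s + m) C s) * (m C j) * (x * (y * z))
    both-sides = begin
      ((s + m) C (s + j)) * ((s + j) C s) * (x * (y * z))
        ≡⟨ solve 5 (λ a b x y z → a :* b :* (x :* (y :* z)) := a :* ((b :* (x :* y)) :* z)) refl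
                 ((s + m) C (s + j)) ((s + j) C s) x y z ⟩
      ((s + m) C (s + j)) * ((((s + j) C s) * (x * y)) * z) ≡⟨ cong (λ t → ((s + m) C (s + j)) * (t * z)) (C-factorial-+ s j) ⟩
      ((s + m) C (s + j)) * ((s + j) ! * z)                 ≡⟨ outer ⟩
      (s + m) !                                             ≡⟨ sym (C-factorial-+ s m) ⟩
      ((s + m) C s) * (x * m !)                             ≡⟨ cong (λ t → ((s + m) C s) * (x * t)) (sym (C-factorial j≤m)) ⟩
      ((s + m) C s) * (x * ((m C j) * (y * z)))
        ≡⟨ solve 5 (λ c d x y z → c :* (x :* (d :* (y :* z))) := c :* d :* (x :* (y :* z))) refl
                 ((s + m) C s) (m C j) x y z ⟩
      ((s + m) C s) * (m C j) * (x * (y * z))               ∎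

open Binomial using (C-choose-twice)

module Development {c ℓ : Level} (R : CommutativeRing c ℓ) where
  open CommutativeRing R
  open RingDefs R
  open RingProperties ring using (-1*x≈-x; -‿distribˡ-*; -‿distribʳ-*; -‿involutive; x[y-z]≈xy-xz; -‿+-comm)
  open AbelianGroupProperties +-abelianGroup using (⁻¹-anti-homo‿-; xyx⁻¹≈y)
  open CommutativeSemigroupProperties *-commutativeSemigroup
    using (interchange; xy∙z≈xz∙y; xy∙z≈y∙xz; x∙yz≈y∙xz)
  open SemiringMult semiring using (×-homo-+; ×1-homo-*) renaming (_×_ to _×ᴿ_)
  open SetoidReasoning setoid

  ≡⇒≈ : ∀ {a b : Carrier} → a P.≡ b → a ≈ b
  ≡⇒≈ P.refl = refl

  Σ-cong : ∀ n {f g : ℕ → Carrier} → (∀ k → f k ≈ g k) → Σ≤ n f ≈ Σ≤ n g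
  Σ-cong zero    eq = eq 0
  Σ-cong (suc n) eq = +-cong (Σ-cong n eq) (eq (suc n))

  Σ-cong-≤ : ∀ n {f g : ℕ → Carrier} → (∀ k → k ≤ n → f k ≈ g k) → Σ≤ n f ≈ Σ≤ n g
  Σ-cong-≤ zero    eq = eq 0 z≤n
  Σ-cong-≤ (suc n) eq = +-cong (Σ-cong-≤ n (λ k k≤n → eq k (ℕP.m≤n⇒m≤1+n k≤n))) (eq (suc n) ℕP.≤-refl)

  Σ-+ : ∀ n (f g : ℕ → Carrier) → Σ≤ n (λ k → f k + g k) ≈ Σ≤ n f + Σ≤ n g
  Σ-+ zero    f g = refl
  Σ-+ (suc n) f g = trans (+-congʳ (Σ-+ n f g))
    (CommutativeSemigroupProperties.interchange +-commutativeSemigroup _ _ _ _)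

  Σ-neg : ∀ n (f : ℕ → Carrier) → Σ≤ n (λ k → - f k) ≈ - Σ≤ n f
  Σ-neg zero    f = refl
  Σ-neg (suc n) f = trans (+-congʳ (Σ-neg n f)) (-‿+-comm _ _)

  Σ-*ˡ : ∀ n a (f : ℕ → Carrier) → Σ≤ n (λ k → a * f k) ≈ a * Σ≤ n f
  Σ-*ˡ zero    a f = refl
  Σ-*ˡ (suc n) a f = trans (+-congʳ (Σ-*ˡ n a f)) (sym (distribˡ a _ _))

  Σ-*ʳ : ∀ n a (f : ℕ → Carrier) → Σ≤ n (λ k → f k * a) ≈ Σ≤ n f * a
  Σ-*ʳ zero    a f = refl
  Σ-*ʳ (suc n) a f = trans (+-congʳ (Σ-*ʳ n a f)) (sym (distribʳ a _ _))

  Σ-swap : ∀ n m (f : ℕ → ℕ → Carrier) →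
           Σ≤ n (λ k → Σ≤ m (λ s → f k s)) ≈ Σ≤ m (λ s → Σ≤ n (λ k → f k s))
  Σ-swap zero    m f = refl
  Σ-swap (suc n) m f = trans (+-congʳ (Σ-swap n m f)) (sym (Σ-+ m (λ s → Σ≤ n (λ k → f k s)) (f (suc n))))

  Σ-head : ∀ n (f : ℕ → Carrier) → Σ≤ (suc n) f ≈ f 0 + Σ≤ n (λ k → f (suc k))
  Σ-head zero    f = refl
  Σ-head (suc n) f = trans (+-congʳ (Σ-head n f)) (+-assoc _ _ _)

  Σ-extend : ∀ k d (f : ℕ → Carrier) → (∀ s → k < s → f s ≈ 0#) → Σ≤ k f ≈ Σ≤ (d ℕ.+ k) f
  Σ-extend k zero    f vanish = refl
  Σ-extend k (suc d) f vanish = begin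
    Σ≤ k f                                  ≈⟨ Σ-extend k d f vanish ⟩
    Σ≤ (d ℕ.+ k) f                          ≈⟨ sym (+-identityʳ _) ⟩
    Σ≤ (d ℕ.+ k) f + 0#                     ≈⟨ +-congˡ (sym (vanish (suc (d ℕ.+ k)) (s≤s (ℕP.m≤n+m k d)))) ⟩
    Σ≤ (d ℕ.+ k) f + f (suc (d ℕ.+ k))      ∎

  Σ-extend-≤ : ∀ {k n} (f : ℕ → Carrier) → k ≤ n → (∀ s → k < s → f s ≈ 0#) → Σ≤ k f ≈ Σ≤ n f
  Σ-extend-≤ {k} {n} f k≤n vanish =
    trans (Σ-extend k (n ∸ k) f vanish) (≡⇒≈ (P.cong (λ t → Σ≤ t f) (ℕP.m∸n+n≡m k≤n)))

  Σ-drop : ∀ s m (f : ℕ → Carrier) → (∀ k → k < s → f k ≈ 0#) → Σ≤ (s ℕ.+ m) f ≈ Σ≤ m (λ j → f (s ℕ.+ j))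
  Σ-drop zero    m f vanish = refl
  Σ-drop (suc s) m f vanish = begin
    Σ≤ (suc (s ℕ.+ m)) f                 ≈⟨ Σ-head (s ℕ.+ m) f ⟩
    f 0 + Σ≤ (s ℕ.+ m) (λ k → f (suc k))  ≈⟨ +-cong (vanish 0 (s≤s z≤n))
                                                    (Σ-drop s m (λ k → f (suc k)) (λ k k<s → vanish (suc k) (s≤s k<s))) ⟩
    0# + Σ≤ m (λ j → f (suc (s ℕ.+ j)))    ≈⟨ +-identityˡ _ ⟩
    Σ≤ m (λ j → f (suc (s ℕ.+ j)))         ∎

  Σ-reverse : ∀ n (g : ℕ → Carrier) → Σ≤ n g ≈ Σ≤ n (λ s → g (n ∸ s))
  Σ-reverse zero    g = refl
  Σ-reverse (suc n) g = begin
    Σ≤ (suc n) g                              ≈⟨ Σ-head n g ⟩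
    g 0 + Σ≤ n (λ k → g (suc k))              ≈⟨ +-congˡ (Σ-reverse n (λ k → g (suc k))) ⟩
    g 0 + Σ≤ n (λ s → g (suc (n ∸ s)))        ≈⟨ +-congˡ (Σ-cong-≤ n (λ s s≤n → ≡⇒≈ (P.cong g (P.sym (ℕP.+-∸-assoc 1 s≤n))))) ⟩
    g 0 + Σ≤ n (λ s → g (suc n ∸ s))          ≈⟨ +-comm _ _ ⟩
    Σ≤ n (λ s → g (suc n ∸ s)) + g 0          ≈⟨ +-congˡ (≡⇒≈ (P.cong g (P.sym (ℕP.n∸n≡0 n)))) ⟩
    Σ≤ n (λ s → g (suc n ∸ s)) + g (suc n ∸ suc n) ∎

  -- ι n is n · 1#, so it is a semiring homomorphism ℕ → R by the library's laws for _×ᴿ_.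
  ι≈×1 : ∀ n → ι n ≈ n ×ᴿ 1#
  ι≈×1 zero    = refl
  ι≈×1 (suc n) = +-congˡ (ι≈×1 n)

  ι-+ : ∀ a b → ι (a ℕ.+ b) ≈ ι a + ι b
  ι-+ a b = trans (ι≈×1 (a ℕ.+ b)) (trans (×-homo-+ 1# a b) (sym (+-cong (ι≈×1 a) (ι≈×1 b))))

  ι-* : ∀ a b → ι (a ℕ.* b) ≈ ι a * ι b
  ι-* a b = trans (ι≈×1 (a ℕ.* b)) (trans (×1-homo-* a b) (sym (*-cong (ι≈×1 a) (ι≈×1 b))))

  ι-C-vanish : ∀ {n k} → n < k → ι (n C k) ≈ 0#
  ι-C-vanish n<k = ≡⇒≈ (P.cong ι (k>n⇒nCk≡0 n<k))

  sgn-+ : ∀ a b → sgn (a ℕ.+ b) ≈ sgn a * sgn b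
  sgn-+ zero    b = sym (*-identityˡ _)
  sgn-+ (suc a) b = trans (-‿cong (sgn-+ a b)) (-‿distribˡ-* _ _)

  sgn-square : ∀ a → sgn a * sgn a ≈ 1#
  sgn-square a = trans (sym (sgn-+ a a)) (sgn-even a)
    where
    sgn-even : ∀ a → sgn (a ℕ.+ a) ≈ 1#
    sgn-even zero    = refl
    sgn-even (suc a) = begin
      - sgn (a ℕ.+ suc a)     ≈⟨ -‿cong (≡⇒≈ (P.cong sgn (ℕP.+-suc a a))) ⟩
      - - sgn (a ℕ.+ a)       ≈⟨ -‿involutive _ ⟩
      sgn (a ℕ.+ a)           ≈⟨ sgn-even a ⟩
      1#                      ∎

  x-[x-y]≈y : ∀ x y → x - (x - y) ≈ y
  x-[x-y]≈y x y = trans (+-congˡ (⁻¹-anti-homo‿- x y)) (trans (sym (+-assoc _ _ _)) (xyx⁻¹≈y x y))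

  doubleSum : (ℕ → Carrier) → (ℕ → Carrier) → ℕ → Carrier
  doubleSum A G n = Σ≤ n (λ k → ι (n C k) * (sgn k * (A k * Σ≤ k (λ s → ι (k C s) * (sgn s * G s)))))

  doubleSum-cong : ∀ A n {G G′ : ℕ → Carrier} → (∀ s → G s ≈ G′ s) → doubleSum A G n ≈ doubleSum A G′ n
  doubleSum-cong A n eq = Σ-cong n (λ k → *-congˡ (*-congˡ (*-congˡ (Σ-cong k (λ s → *-congˡ (*-congˡ (eq s)))))))

  module SelfReciprocal (A : ℕ → Carrier) (ε : Carrier) (ε²≈1 : ε * ε ≈ 1#)
                        (reciprocal : ∀ n → binomT A n ≈ ε * A n) where

    Δ : ℕ → ℕ → Carrier
    Δ m s = Σ≤ m (λ j → ι (m C j) * (sgn j * A (s ℕ.+ j)))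

    Δ-pascal : ∀ m s → Δ (suc m) s ≈ Δ m s - Δ m (suc s)
    Δ-pascal m s = begin
      Δ (suc m) s                                   ≈⟨ Σ-head m _ ⟩
      f 0 + Σ≤ m (λ j → ι (suc m C suc j) * (sgn (suc j) * A (s ℕ.+ suc j)))
                                                    ≈⟨ +-congˡ (trans (Σ-cong m split) (Σ-+ m shifted (λ j → f (suc j)))) ⟩
      f 0 + (Σ≤ m shifted + Σ≤ m (λ j → f (suc j))) ≈⟨ CommutativeSemigroupProperties.x∙yz≈xz∙y +-commutativeSemigroup _ _ _ ⟩
      (f 0 + Σ≤ m (λ j → f (suc j))) + Σ≤ m shifted  ≈⟨ +-cong (sym (Σ-head m f)) (Σ-neg m _) ⟩
      (Σ≤ m f + f (suc m)) - Δ m (suc s)            ≈⟨ +-congʳ (+-congˡ (trans (*-congʳ (ι-C-vanish (ℕP.n<1+n m))) (zeroˡ _))) ⟩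
      (Σ≤ m f + 0#) - Δ m (suc s)                   ≈⟨ +-congʳ (+-identityʳ _) ⟩
      Δ m s - Δ m (suc s)                           ∎
      where
      f : ℕ → Carrier
      f j = ι (m C j) * (sgn j * A (s ℕ.+ j))
      shifted : ℕ → Carrier
      shifted j = - (ι (m C j) * (sgn j * A (suc s ℕ.+ j)))
      -- Pascal's rule C(m+1,j+1) = C(m,j) + C(m,j+1) splits each term in two.
      split : ∀ j → ι (suc m C suc j) * (sgn (suc j) * A (s ℕ.+ suc j)) ≈ shifted j + f (suc j)
      split j = begin
        ι (suc m C suc j) * (sgn (suc j) * A (s ℕ.+ suc j))
          ≈⟨ *-congʳ (trans (≡⇒≈ (P.cong ι (P.sym (nCk+nC[k+1]≡[n+1]C[k+1] m j)))) (ι-+ (m C j) (m C suc j))) ⟩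
        (ι (m C j) + ι (m C suc j)) * (sgn (suc j) * A (s ℕ.+ suc j))     ≈⟨ distribʳ _ _ _ ⟩
        ι (m C j) * (- sgn j * A (s ℕ.+ suc j)) + f (suc j)
          ≈⟨ +-congʳ (*-congˡ (*-congˡ (≡⇒≈ (P.cong A (ℕP.+-suc s j))))) ⟩
        ι (m C j) * (- sgn j * A (suc s ℕ.+ j)) + f (suc j)
          ≈⟨ +-congʳ (trans (*-congˡ (sym (-‿distribˡ-* _ _))) (sym (-‿distribʳ-* _ _))) ⟩
        shifted j + f (suc j)                                             ∎

    -- Δ m s = ε · Δ s m; at m = 0 this is the hypothesis A s = ε · binomT A s.
    Δ-symmetric : ∀ m s → Δ m s ≈ ε * Δ s m
    Δ-symmetric zero s = begin
      (1# + 0#) * (1# * A (s ℕ.+ 0)) ≈⟨ *-cong (+-identityʳ 1#) (*-identityˡ _) ⟩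
      1# * A (s ℕ.+ 0)               ≈⟨ *-identityˡ _ ⟩
      A (s ℕ.+ 0)                    ≈⟨ ≡⇒≈ (P.cong A (ℕP.+-identityʳ s)) ⟩
      A s                            ≈⟨ sym (*-identityˡ _) ⟩
      1# * A s                       ≈⟨ *-congʳ (sym ε²≈1) ⟩
      (ε * ε) * A s                  ≈⟨ *-assoc _ _ _ ⟩
      ε * (ε * A s)                  ≈⟨ *-congˡ (sym (reciprocal s)) ⟩
      ε * Δ s 0                      ∎
    Δ-symmetric (suc m) s = begin
      Δ (suc m) s                             ≈⟨ Δ-pascal m s ⟩
      Δ m s - Δ m (suc s)                     ≈⟨ +-cong (Δ-symmetric m s) (-‿cong (Δ-symmetric m (suc s))) ⟩
      ε * Δ s m - ε * Δ (suc s) m             ≈⟨ sym (x[y-z]≈xy-xz ε _ _) ⟩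
      ε * (Δ s m - Δ (suc s) m)               ≈⟨ *-congˡ (+-congˡ (-‿cong (Δ-pascal s m))) ⟩
      ε * (Δ s m - (Δ s m - Δ s (suc m)))     ≈⟨ *-congˡ (x-[x-y]≈y _ _) ⟩
      ε * Δ s (suc m)                         ∎

    -- The weight of G s after exchanging the two sums of doubleSum.
    W : ℕ → ℕ → Carrier
    W n s = Σ≤ n (λ k → (ι (n C k) * (sgn k * A k)) * (ι (k C s) * sgn s))

    -- Only k ≥ s contribute; writing k = s + j turns W into a multiple of Δ.
    W-difference : ∀ {n} s m → s ℕ.+ m P.≡ n → W n s ≈ ι (n C s) * Δ m s
    W-difference s m P.refl = begin
      W (s ℕ.+ m) s
        ≈⟨ Σ-drop s m _ (λ k k<s → trans (*-congˡ (trans (*-congʳ (ι-C-vanish k<s)) (zeroˡ _))) (zeroʳ _)) ⟩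
      Σ≤ m (λ j → (ι ((s ℕ.+ m) C (s ℕ.+ j)) * (sgn (s ℕ.+ j) * A (s ℕ.+ j))) * (ι ((s ℕ.+ j) C s) * sgn s))
        ≈⟨ Σ-cong m term ⟩
      Σ≤ m (λ j → ι ((s ℕ.+ m) C s) * (ι (m C j) * (sgn j * A (s ℕ.+ j))))
        ≈⟨ Σ-*ˡ m _ _ ⟩
      ι ((s ℕ.+ m) C s) * Δ m s ∎
      where
      term : ∀ j → (ι ((s ℕ.+ m) C (s ℕ.+ j)) * (sgn (s ℕ.+ j) * A (s ℕ.+ j))) * (ι ((s ℕ.+ j) C s) * sgn s)
                 ≈ ι ((s ℕ.+ m) C s) * (ι (m C j) * (sgn j * A (s ℕ.+ j)))
      term j = begin
        (a * (σ * x)) * (b * t)    ≈⟨ interchange a (σ * x) b t ⟩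
        (a * b) * ((σ * x) * t)    ≈⟨ *-congˡ (xy∙z≈xz∙y σ x t) ⟩
        (a * b) * ((σ * t) * x)    ≈⟨ *-cong coefficients (*-congʳ signs) ⟩
        (ι ((s ℕ.+ m) C s) * ι (m C j)) * (sgn j * x) ≈⟨ *-assoc _ _ _ ⟩
        ι ((s ℕ.+ m) C s) * (ι (m C j) * (sgn j * x)) ∎
        where
        a = ι ((s ℕ.+ m) C (s ℕ.+ j))
        σ = sgn (s ℕ.+ j)
        x = A (s ℕ.+ j)
        b = ι ((s ℕ.+ j) C s)
        t = sgn s
        coefficients : a * b ≈ ι ((s ℕ.+ m) C s) * ι (m C j)
        coefficients = trans (sym (ι-* ((s ℕ.+ m) C (s ℕ.+ j)) ((s ℕ.+ j) C s)))
                             (trans (≡⇒≈ (P.cong ι (C-choose-twice s m j))) (ι-* ((s ℕ.+ m) C s) (m C j)))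
        signs : σ * t ≈ sgn j
        signs = begin
          σ * t            ≈⟨ *-congʳ (sgn-+ s j) ⟩
          (t * sgn j) * t  ≈⟨ xy∙z≈y∙xz t (sgn j) t ⟩
          sgn j * (t * t)  ≈⟨ *-congˡ (sgn-square s) ⟩
          sgn j * 1#       ≈⟨ *-identityʳ _ ⟩
          sgn j            ∎

    W-reflect : ∀ {n s} → s ≤ n → W n (n ∸ s) ≈ ε * W n s
    W-reflect {n} {s} s≤n = begin
      W n (n ∸ s)                           ≈⟨ W-difference (n ∸ s) s (P.trans (ℕP.+-comm (n ∸ s) s) (ℕP.m+[n∸m]≡n s≤n)) ⟩
      ι (n C (n ∸ s)) * Δ s (n ∸ s)         ≈⟨ *-cong (≡⇒≈ (P.cong ι (P.sym (nCk≡nC[n∸k] s≤n)))) (Δ-symmetric s (n ∸ s)) ⟩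
      ι (n C s) * (ε * Δ (n ∸ s) s)         ≈⟨ x∙yz≈y∙xz _ _ _ ⟩
      ε * (ι (n C s) * Δ (n ∸ s) s)         ≈⟨ *-congˡ (sym (W-difference s (n ∸ s) (ℕP.m+[n∸m]≡n s≤n))) ⟩
      ε * W n s                             ∎

    doubleSum-weights : ∀ G n → doubleSum A G n ≈ Σ≤ n (λ s → W n s * G s)
    doubleSum-weights G n = begin
      doubleSum A G n                                                   ≈⟨ Σ-cong-≤ n row ⟩
      Σ≤ n (λ k → Σ≤ n (λ s → (cf k * (ι (k C s) * sgn s)) * G s))     ≈⟨ Σ-swap n n _ ⟩
      Σ≤ n (λ s → Σ≤ n (λ k → (cf k * (ι (k C s) * sgn s)) * G s))     ≈⟨ Σ-cong n (λ s → Σ-*ʳ n (G s) _) ⟩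
      Σ≤ n (λ s → W n s * G s)                                          ∎
      where
      cf : ℕ → Carrier
      cf k = ι (n C k) * (sgn k * A k)
      row : ∀ k → k ≤ n → ι (n C k) * (sgn k * (A k * Σ≤ k (λ s → ι (k C s) * (sgn s * G s))))
                        ≈ Σ≤ n (λ s → (cf k * (ι (k C s) * sgn s)) * G s)
      row k k≤n = begin
        ι (n C k) * (sgn k * (A k * I))                       ≈⟨ trans (*-congˡ (sym (*-assoc _ _ _))) (sym (*-assoc _ _ _)) ⟩
        cf k * I                                              ≈⟨ *-congˡ (Σ-extend-≤ _ k≤n (λ s k<s → trans (*-congʳ (ι-C-vanish k<s)) (zeroˡ _))) ⟩
        cf k * Σ≤ n (λ s → ι (k C s) * (sgn s * G s))         ≈⟨ sym (Σ-*ˡ n _ _) ⟩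
        Σ≤ n (λ s → cf k * (ι (k C s) * (sgn s * G s)))       ≈⟨ Σ-cong n (λ s → trans (*-congˡ (sym (*-assoc _ _ _))) (sym (*-assoc _ _ _))) ⟩
        Σ≤ n (λ s → (cf k * (ι (k C s) * sgn s)) * G s)       ∎
        where
        I = Σ≤ k (λ s → ι (k C s) * (sgn s * G s))

    weights-reflect : ∀ F n → Σ≤ n (λ s → W n s * F (n ∸ s)) ≈ ε * Σ≤ n (λ s → W n s * F s)
    weights-reflect F n = begin
      Σ≤ n (λ s → W n s * F (n ∸ s))               ≈⟨ Σ-reverse n _ ⟩
      Σ≤ n (λ s → W n (n ∸ s) * F (n ∸ (n ∸ s)))   ≈⟨ Σ-cong-≤ n (λ s s≤n → *-cong (W-reflect s≤n) (≡⇒≈ (P.cong F (ℕP.m∸[m∸n]≡n s≤n)))) ⟩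
      Σ≤ n (λ s → (ε * W n s) * F s)               ≈⟨ Σ-cong n (λ s → *-assoc _ _ _) ⟩
      Σ≤ n (λ s → ε * (W n s * F s))               ≈⟨ Σ-*ˡ n ε _ ⟩
      ε * Σ≤ n (λ s → W n s * F s)                 ∎

    doubleSum-vanishes : ∀ F η → η * ε ≈ - 1# → ∀ n → doubleSum A (λ s → F s + η * F (n ∸ s)) n ≈ 0#
    doubleSum-vanishes F η ηε≈-1 n = begin
      doubleSum A (λ s → F s + η * F (n ∸ s)) n         ≈⟨ doubleSum-weights _ n ⟩
      Σ≤ n (λ s → W n s * (F s + η * F (n ∸ s)))        ≈⟨ Σ-cong n (λ s → trans (distribˡ _ _ _) (+-congˡ (x∙yz≈y∙xz _ _ _))) ⟩
      Σ≤ n (λ s → W n s * F s + η * (W n s * F (n ∸ s))) ≈⟨ Σ-+ n _ _ ⟩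
      X + Σ≤ n (λ s → η * (W n s * F (n ∸ s)))          ≈⟨ +-congˡ (trans (Σ-*ˡ n η _) (*-congˡ (weights-reflect F n))) ⟩
      X + η * (ε * X)                                   ≈⟨ +-congˡ (trans (sym (*-assoc _ _ _)) (*-congʳ ηε≈-1)) ⟩
      X + - 1# * X                                      ≈⟨ +-congˡ (-1*x≈-x X) ⟩
      X - X                                             ≈⟨ -‿inverseʳ X ⟩
      0#                                                ∎
      where
      X = Σ≤ n (λ s → W n s * F s)

  -- Even sequences: ε = 1 and η = -1, since F s - F (n-s) = F s + (-1) F (n-s).
  even-vanishes : ∀ (F A : ℕ → Carrier) → IsEven A → ∀ n → evenExpr A F n ≈ 0#
  even-vanishes F A even n =
    trans (doubleSum-cong A n (λ s → +-congˡ (sym (-1*x≈-x _))))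
          (doubleSum-vanishes F (- 1#) (*-identityʳ _) n)
    where open SelfReciprocal A 1# (*-identityˡ 1#) (λ m → trans (even m) (sym (*-identityˡ _)))

  odd-vanishes : ∀ (F A : ℕ → Carrier) → IsOdd A → ∀ n → oddExpr A F n ≈ 0#
  odd-vanishes F A odd n =
    trans (doubleSum-cong A n (λ s → +-congˡ (sym (*-identityˡ _))))
          (doubleSum-vanishes F 1# (*-identityˡ _) n)
    where open SelfReciprocal A (- 1#) (trans (-1*x≈-x (- 1#)) (-‿involutive 1#)) (λ m → trans (odd m) (sym (-1*x≈-x _)))

open CommutativeRing using (Carrier; _≈_; 0#)
open RingDefs using (IsEven; IsOdd; evenExpr; oddExpr)

theorem2p10 : {c ℓ : Level} (R : CommutativeRing c ℓ) (F : ℕ → Carrier R) (A : ℕ → Carrier R) →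
    (IsEven R A → ∀ n → _≈_ R (evenExpr R A F n) (0# R)) × (IsOdd R A → ∀ n → _≈_ R (oddExpr R A F n) (0# R))
theorem2p10 R F A = Development.even-vanishes R F A , Development.odd-vanishes R F A
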